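{- No vertex of degree $3$ in $G$ is adjacent to two other vertices of degree $3$. In particular, if $u$ is a vertex of degree $3$ on a $(3,3,5^+)$-face $f$, then the neighbor of $u$ not on $f$ has degree at least $4$.
   Context: A $(1,1,0)$-coloring of a graph is an assignment of colors from $\{1,2,3\}$ to its vertices such that every vertex of color $1$ has at most one neighbor of color $1$, every vertex of color $2$ has at most one neighbor of color $2$, and no two adjacent vertices both have color $3$. Throughout, $G$ is a fixed plane graph (planar graph with a fixed embedding) containing no cycle of length $4$ or $5$, which has no $(1,1,0)$-coloring but every proper subgraph of which has a $(1,1,0)$-coloring. A $3$-face is a face bounded by a triangle. An $(\ell_1,\ell_2,\ell_3)$-face is a $3$-face whose three vertices have degrees $\ell_1,\ell_2,\ell_3$ (in some order), where an entry $\ell^+$ means degree at least $\ell$. -}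

module Defs where

open import Data.Nat using (ℕ; zero; suc; _+_; _≤_)
open import Data.Fin using (Fin; _≟_)
open import Data.Fin.Base using () renaming (zero to f0; suc to fs)
open import Data.Bool using (Bool; true; false; if_then_else_; _∧_)
open import Data.List using (List; map; allFin)
open import Data.Nat.ListAction using (sum)
open import Data.Product using (Σ; ∃; _×_; _,_)
open import Data.Sum using (_⊎_)
open import Relation.Binary.PropositionalEquality using (_≡_; _≢_)
open import Relation.Nullary using (¬_)
open import Relation.Nullary.Decidable using (⌊_⌋)

record Graph (n : ℕ) : Set where
  field
    adj    : Fin n → Fin n → Bool
    sym    : ∀ u v → adj u v ≡ adj v u
    irrefl : ∀ v → adj v v ≡ false
open Graph public

Adj : ∀ {n} → Graph n → Fin n → Fin n → Set
Adj G u v = adj G u v ≡ true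

count : ∀ {n} → (Fin n → Bool) → ℕ
count {n} p = sum (map (λ w → if p w then 1 else 0) (allFin n))

deg : ∀ {n} → Graph n → Fin n → ℕ
deg G v = count (adj G v)

record Subgraph {n : ℕ} (G : Graph n) : Set where
  field
    vs     : Fin n → Bool
    es     : Fin n → Fin n → Bool
    es-sym : ∀ u v → es u v ≡ es v u
    es⊆adj : ∀ u v → es u v ≡ true → adj G u v ≡ true
    es-vs  : ∀ u v → es u v ≡ true → vs u ≡ true
open Subgraph public

whole : ∀ {n} (G : Graph n) → Subgraph G
whole G = record
  { vs = λ _ → true ; es = adj G ; es-sym = sym G
  ; es⊆adj = λ u v e → e ; es-vs = λ u v e → Relation.Binary.PropositionalEquality.refl }

Proper : ∀ {n} {G : Graph n} → Subgraph G → Set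
Proper {n} {G} H =
  (∃ λ v → vs H v ≡ false) ⊎ (Σ (Fin n) λ u → Σ (Fin n) λ v → adj G u v ≡ true × es H u v ≡ false)

-- Colours: f0, fs f0, fs (fs f0) represent the colours 1, 2, 3.
-- Allowed number of same-coloured neighbours: 1 for colours 1,2; 0 for colour 3.
allow : Fin 3 → ℕ
allow f0 = 1
allow (fs f0) = 1
allow (fs (fs f0)) = 0

Is110Colouring : ∀ {n} {G : Graph n} → Subgraph G → (Fin n → Fin 3) → Set
Is110Colouring H c =
  ∀ v → vs H v ≡ true → count (λ w → es H v w ∧ ⌊ c w ≟ c v ⌋) ≤ allow (c v)

Colourable110 : ∀ {n} {G : Graph n} → Subgraph G → Set
Colourable110 {n} H = ∃ λ (c : Fin n → Fin 3) → Is110Colouring H c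

NoC4 : ∀ {n} → Graph n → Set
NoC4 {n} G = ∀ (a b c d : Fin n) →
  a ≢ b → a ≢ c → a ≢ d → b ≢ c → b ≢ d → c ≢ d →
  Adj G a b → Adj G b c → Adj G c d → ¬ Adj G d a

NoC5 : ∀ {n} → Graph n → Set
NoC5 {n} G = ∀ (a b c d e : Fin n) →
  a ≢ b → a ≢ c → a ≢ d → a ≢ e → b ≢ c → b ≢ d → b ≢ e → c ≢ d → c ≢ e → d ≢ e →
  Adj G a b → Adj G b c → Adj G c d → Adj G d e → ¬ Adj G e a

Minimal110 : ∀ {n} → Graph n → Set
Minimal110 G = ¬ Colourable110 (whole G) × (∀ (H : Subgraph G) → Proper H → Colourable110 H)

{-# OPTIONS --safe #-}
-- Let u have degree at most 3 and two distinct neighbours v, w of degree at most 3.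
-- By minimality G − u has a (1,1,0)-colouring. In G − u, v and w have at most two
-- neighbours each, so each can be recoloured with a colour missing from its neighbourhood;
-- afterwards neither has a neighbour of its own colour. Besides v and w, u has at most one
-- neighbour z. Give u a colour a different from that of z, shared by at most one of v, w,
-- and not 3 if it is shared: the only new clashes are the one at u and the one at v or w,
-- each within the allowance of colour a. This colours G, contradicting minimality.
module Submission where

open import Defs hiding (sym)
open import Data.Bool using (Bool; true; false; if_then_else_; _∧_; not)
import Data.Bool as Bool
open import Data.Bool.Properties using (∧-identityʳ; ∧-zeroʳ; ∧-comm)
open import Data.Empty using (⊥; ⊥-elim)
open import Data.Fin using (Fin; _≟_)
open import Data.Fin.Base using () renaming (zero to f0; suc to fs)
open import Data.Fin.Properties using (any?)
open import Data.List.Properties using (map-tabulate)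
open import Data.Nat using (ℕ; zero; suc; _+_; _≤_; z≤n; s≤s)
open import Data.Nat.ListAction using (sum)
open import Data.Nat.Properties
  using (module ≤-Reasoning; ≤-refl; ≤-trans; ≤-reflexive; ≤-pred; ≰⇒>; n≤0⇒n≡0; +-mono-≤;
         +-commutativeSemigroup)
open import Data.Nat.Tactic.RingSolver using (solve-∀)
open import Algebra.Properties.CommutativeSemigroup +-commutativeSemigroup using (x∙yz≈y∙xz)
open import Data.Product using (∃; _×_; _,_; proj₂)
open import Data.Sum using (_⊎_; inj₁; inj₂; [_,_]′)
open import Data.Vec.Functional using (updateAt)
open import Data.Vec.Functional.Properties using (updateAt-updates; updateAt-minimal)
open import Function using (_∘_; const; case_of_)
open import Relation.Binary.PropositionalEquality
open import Relation.Nullary using (¬_; yes; no; contradiction)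
open import Relation.Nullary.Decidable using (Dec; ⌊_⌋; dec-true; dec-false; isYes≗does; ⌊⌋-map′)

pattern ① = f0
pattern ② = fs f0
pattern ③ = fs (fs f0)

indicator : Bool → ℕ
indicator b = if b then 1 else 0

∧-intro : ∀ {x y} → x ≡ true → y ≡ true → x ∧ y ≡ true
∧-intro refl refl = refl

∧-elimˡ : ∀ {x y} → x ∧ y ≡ true → x ≡ true
∧-elimˡ {true} _ = refl

∧-elimʳ : ∀ {x y} → x ∧ y ≡ true → y ≡ true
∧-elimʳ {true} e = e

⌊⌋-true : ∀ {A : Set} (a? : Dec A) → A → ⌊ a? ⌋ ≡ true
⌊⌋-true a? a = trans (isYes≗does a?) (dec-true a? a)

⌊⌋-false : ∀ {A : Set} (a? : Dec A) → ¬ A → ⌊ a? ⌋ ≡ false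
⌊⌋-false a? ¬a = trans (isYes≗does a?) (dec-false a? ¬a)

⌊⌋-witness : ∀ {A : Set} (a? : Dec A) → ⌊ a? ⌋ ≡ true → A
⌊⌋-witness (yes a) _ = a

∧-⌊⌋ : ∀ {x} {A : Set} (a? : Dec A) → x ∧ ⌊ a? ⌋ ≡ true → x ≡ true × A
∧-⌊⌋ {x} a? e = ∧-elimˡ e , ⌊⌋-witness a? (∧-elimʳ {x} e)

count-suc : ∀ {n} (p : Fin (suc n) → Bool) → count p ≡ indicator (p f0) + count (p ∘ fs)
count-suc p = cong (λ xs → indicator (p f0) + sum xs)
  (trans (map-tabulate fs (indicator ∘ p)) (sym (map-tabulate (λ i → i) (indicator ∘ p ∘ fs))))

count-cong : ∀ {n} {p q : Fin n → Bool} → (∀ w → p w ≡ q w) → count p ≡ count q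
count-cong {zero} p≗q = refl
count-cong {suc n} {p} {q} p≗q = begin
  count p                              ≡⟨ count-suc p ⟩
  indicator (p f0) + count (p ∘ fs)    ≡⟨ cong₂ _+_ (cong indicator (p≗q f0)) (count-cong (p≗q ∘ fs)) ⟩
  indicator (q f0) + count (q ∘ fs)    ≡⟨ count-suc q ⟨
  count q                              ∎
  where open ≡-Reasoning

indicator-mono : ∀ {x y} → (x ≡ true → y ≡ true) → indicator x ≤ indicator y
indicator-mono {false} _ = z≤n
indicator-mono {true} x⇒y rewrite x⇒y refl = ≤-refl

count-mono : ∀ {n} {p q : Fin n → Bool} → (∀ w → p w ≡ true → q w ≡ true) → count p ≤ count q
count-mono {zero} _ = z≤n
count-mono {suc n} {p} {q} p⊆q rewrite count-suc p | count-suc q =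
  +-mono-≤ (indicator-mono (p⊆q f0)) (count-mono (p⊆q ∘ fs))

count≡0 : ∀ {n} {p : Fin n → Bool} → (∀ w → p w ≢ true) → count p ≡ 0
count≡0 {zero} _ = refl
count≡0 {suc n} {p} none rewrite count-suc p with p f0 in e
... | true = ⊥-elim (none f0 e)
... | false = count≡0 (none ∘ fs)

count-except : ∀ {n} (p : Fin n → Bool) (x : Fin n) →
  count p ≡ indicator (p x) + count (λ w → p w ∧ not ⌊ w ≟ x ⌋)
count-except {suc n} p f0 rewrite count-suc (λ w → p w ∧ not ⌊ w ≟ f0 ⌋) | ∧-zeroʳ (p f0) =
  trans (count-suc p) (cong (indicator (p f0) +_) (count-cong (λ w → sym (∧-identityʳ (p (fs w))))))
count-except {suc n} p (fs x) = begin
  count p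
    ≡⟨ count-suc p ⟩
  indicator (p f0) + count (p ∘ fs)
    ≡⟨ cong (indicator (p f0) +_) (count-except (p ∘ fs) x) ⟩
  indicator (p f0) + (indicator (p (fs x)) + count rest)
    ≡⟨ x∙yz≈y∙xz (indicator (p f0)) (indicator (p (fs x))) (count rest) ⟩
  indicator (p (fs x)) + (indicator (p f0) + count rest)
    ≡⟨ cong (indicator (p (fs x)) +_) except-suc ⟨
  indicator (p (fs x)) + count except
    ∎
  where
  open ≡-Reasoning
  rest : Fin n → Bool
  rest w = p (fs w) ∧ not ⌊ w ≟ x ⌋
  except : Fin (suc n) → Bool
  except w = p w ∧ not ⌊ w ≟ fs x ⌋
  except-suc : count except ≡ indicator (p f0) + count rest
  except-suc = trans (count-suc except) (cong₂ _+_ (cong indicator (∧-identityʳ (p f0)))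
    (count-cong λ w → cong (λ b → p (fs w) ∧ not b) (⌊⌋-map′ _ _ (w ≟ x))))

+-interchange₃ : ∀ a b c x y z → (a + x) + (b + y) + (c + z) ≡ (a + b + c) + (x + y + z)
+-interchange₃ = solve-∀

colourClass : ∀ {n} → (Fin n → Bool) → (Fin n → Fin 3) → Fin 3 → ℕ
colourClass p c a = count (λ w → p w ∧ ⌊ c w ≟ a ⌋)

indicator-by-colour : ∀ b (k : Fin 3) →
  indicator b ≡ indicator (b ∧ ⌊ k ≟ ① ⌋) + indicator (b ∧ ⌊ k ≟ ② ⌋) + indicator (b ∧ ⌊ k ≟ ③ ⌋)
indicator-by-colour false _ = refl
indicator-by-colour true ① = refl
indicator-by-colour true ② = refl
indicator-by-colour true ③ = refl

count-by-colour : ∀ {n} (p : Fin n → Bool) (c : Fin n → Fin 3) →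
  count p ≡ colourClass p c ① + colourClass p c ② + colourClass p c ③
count-by-colour {zero} p c = refl
count-by-colour {suc n} p c = begin
  count p
    ≡⟨ count-suc p ⟩
  indicator (p f0) + count (p ∘ fs)
    ≡⟨ cong₂ _+_ (indicator-by-colour (p f0) (c f0)) (count-by-colour (p ∘ fs) (c ∘ fs)) ⟩
  (head ① + head ② + head ③) + (tail ① + tail ② + tail ③)
    ≡⟨ +-interchange₃ (head ①) (head ②) (head ③) (tail ①) (tail ②) (tail ③) ⟨
  (head ① + tail ①) + (head ② + tail ②) + (head ③ + tail ③)
    ≡⟨ cong₂ _+_ (cong₂ _+_ (count-suc (class ①)) (count-suc (class ②))) (count-suc (class ③)) ⟨
  colourClass p c ① + colourClass p c ② + colourClass p c ③
    ∎
  where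
  open ≡-Reasoning
  class : Fin 3 → Fin (suc n) → Bool
  class a w = p w ∧ ⌊ c w ≟ a ⌋
  head : Fin 3 → ℕ
  head a = indicator (class a f0)
  tail : Fin 3 → ℕ
  tail a = count (class a ∘ fs)

count-remove : ∀ {n} (p : Fin n → Bool) (x : Fin n) → p x ≡ true →
  count p ≡ suc (count (λ w → p w ∧ not ⌊ w ≟ x ⌋))
count-remove p x px =
  trans (count-except p x) (cong (λ b → indicator b + count (λ w → p w ∧ not ⌊ w ≟ x ⌋)) px)

count-witness : ∀ {n} {p : Fin n → Bool} (x : Fin n) → p x ≡ true → 1 ≤ count p
count-witness {p = p} x px = subst (1 ≤_) (sym (count-remove p x px)) (s≤s z≤n)

count≤1⇒unique : ∀ {n} {p : Fin n → Bool} → count p ≤ 1 →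
  ∀ x y → p x ≡ true → p y ≡ true → x ≡ y
count≤1⇒unique {p = p} p≤1 x y px py with y ≟ x
... | yes y≡x = sym y≡x
... | no y≢x = contradiction (≤-trans (count-witness y other-y) others≤0) λ ()
  where
  others : Fin _ → Bool
  others w = p w ∧ not ⌊ w ≟ x ⌋
  other-y : others y ≡ true
  other-y = ∧-intro py (cong not (⌊⌋-false (y ≟ x) y≢x))
  others≤0 : count others ≤ 0
  others≤0 = ≤-pred (subst (_≤ 1) (count-remove p x px) p≤1)

unique⇒count≤1 : ∀ {n} {p : Fin n → Bool} → (∀ x y → p x ≡ true → p y ≡ true → x ≡ y) → count p ≤ 1
unique⇒count≤1 {p = p} unique with any? (λ x → p x Bool.≟ true)
... | no none = subst (_≤ 1) (sym (count≡0 λ x px → none (x , px))) z≤n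
... | yes (x , px) = ≤-reflexive (trans (count-remove p x px) (cong suc (count≡0 others-absent)))
  where
  others-absent : ∀ y → p y ∧ not ⌊ y ≟ x ⌋ ≢ true
  others-absent y e with unique x y px (∧-elimˡ e)
  ... | refl = case trans (sym (∧-elimʳ {p x} e)) (cong not (⌊⌋-true (x ≟ x) refl)) of λ ()

some-summand-zero : ∀ a b c → a + b + c ≤ 2 → a ≡ 0 ⊎ b ≡ 0 ⊎ c ≡ 0
some-summand-zero zero    _       _       _ = inj₁ refl
some-summand-zero (suc _) zero    _       _ = inj₂ (inj₁ refl)
some-summand-zero (suc _) (suc _) zero    _ = inj₂ (inj₂ refl)
some-summand-zero (suc a) (suc b) (suc c) sum≤2 =
  contradiction (≤-trans three≤sum sum≤2) λ { (s≤s (s≤s ())) }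
  where
  three≤sum : 3 ≤ suc a + suc b + suc c
  three≤sum = +-mono-≤ (+-mono-≤ (s≤s (z≤n {a})) (s≤s (z≤n {b}))) (s≤s (z≤n {c}))

colourClass≡0⇒unused : ∀ {n} {p : Fin n → Bool} {c : Fin n → Fin 3} {a} →
  colourClass p c a ≡ 0 → ∀ y → p y ≡ true → c y ≢ a
colourClass≡0⇒unused {c = c} {a} empty y py cy =
  contradiction (subst (1 ≤_) empty (count-witness y (∧-intro py (⌊⌋-true (c y ≟ a) cy)))) λ ()

unused-colour : ∀ {n} (p : Fin n → Bool) → count p ≤ 2 → (c : Fin n → Fin 3) →
  ∃ λ a → ∀ y → p y ≡ true → c y ≢ a
unused-colour p p≤2 c with some-summand-zero _ _ _ (subst (_≤ 2) (count-by-colour p c) p≤2)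
... | inj₁ empty          = ① , colourClass≡0⇒unused empty
... | inj₂ (inj₁ empty)   = ② , colourClass≡0⇒unused empty
... | inj₂ (inj₂ empty)   = ③ , colourClass≡0⇒unused empty

module _ {n : ℕ} {p : Fin n → Bool} {v w : Fin n} (pv : p v ≡ true) (pw : p w ≡ true) (v≢w : v ≢ w) where

  private
    rest : Fin n → Bool
    rest y = (p y ∧ not ⌊ y ≟ v ⌋) ∧ not ⌊ y ≟ w ⌋

    count-rest : count p ≡ 2 + count rest
    count-rest = trans (count-remove p v pv) (cong suc (count-remove _ w pw′))
      where
      pw′ : p w ∧ not ⌊ w ≟ v ⌋ ≡ true
      pw′ = ∧-intro pw (cong not (⌊⌋-false (w ≟ v) (v≢w ∘ sym)))

    v-w-or-rest : ∀ {A : Set} y → p y ≡ true → (rest y ≡ true → A) → y ≡ v ⊎ y ≡ w ⊎ A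
    v-w-or-rest y py k with y ≟ v | y ≟ w
    ... | yes y≡v | _       = inj₁ y≡v
    ... | no _    | yes y≡w = inj₂ (inj₁ y≡w)
    ... | no _    | no _    = inj₂ (inj₂ (k (∧-intro (∧-intro py refl) refl)))

  count≤3⇒third : count p ≤ 3 → ∃ λ z → ∀ y → p y ≡ true → y ≡ v ⊎ y ≡ w ⊎ y ≡ z
  count≤3⇒third p≤3 with any? (λ y → rest y Bool.≟ true)
  ... | yes (z , rz) = z , λ y py → v-w-or-rest y py λ ry → count≤1⇒unique rest≤1 y z ry rz
    where
    rest≤1 : count rest ≤ 1
    rest≤1 = ≤-pred (≤-pred (subst (_≤ 3) count-rest p≤3))
  ... | no none = v , λ y py → v-w-or-rest y py λ ry → ⊥-elim (none (y , ry))

adj⇒≢ : ∀ {n} (G : Graph n) {x y : Fin n} → Adj G x y → x ≢ y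
adj⇒≢ G {x} xy refl = case trans (sym xy) (irrefl G x) of λ ()

module _ {n : ℕ} {G : Graph n} where

  clashes : Subgraph G → (Fin n → Fin 3) → Fin n → ℕ
  clashes H c v = count (λ w → es H v w ∧ ⌊ c w ≟ c v ⌋)

  module Recolouring (H : Subgraph G) (c : Fin n → Fin 3) (v : Fin n) (a : Fin 3)
                     (avoids : ∀ y → es H v y ≡ true → c y ≢ a) where

    c′ : Fin n → Fin 3
    c′ = updateAt c v (const a)

    recoloured-free : clashes H c′ v ≡ 0
    recoloured-free = count≡0 λ w e → let (vw , same) = ∧-⌊⌋ (c′ w ≟ c′ v) e in clash w vw same
      where
      clash : ∀ w → es H v w ≡ true → c′ w ≢ c′ v
      clash w vw same = avoids w vw (begin
        c w   ≡⟨ updateAt-minimal w v c (adj⇒≢ G (es⊆adj H v w vw) ∘ sym) ⟨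
        c′ w  ≡⟨ same ⟩
        c′ v  ≡⟨ updateAt-updates v c ⟩
        a     ∎)
        where open ≡-Reasoning

    recoloured-elsewhere : ∀ y → y ≢ v → clashes H c′ y ≤ clashes H c y
    recoloured-elsewhere y y≢v = count-mono λ w e →
      let (yw , same) = ∧-⌊⌋ (c′ w ≟ c′ y) e in ∧-intro yw (⌊⌋-true (c w ≟ c y) (same-colour w yw same))
      where
      c′y≡cy : c′ y ≡ c y
      c′y≡cy = updateAt-minimal y v c y≢v
      same-colour : ∀ w → es H y w ≡ true → c′ w ≡ c′ y → c w ≡ c y
      same-colour w yw same with w ≟ v
      ... | yes refl = contradiction (trans (sym c′y≡cy) (trans (sym same) (updateAt-updates v c)))
                                     (avoids y (trans (es-sym H v y) yw))
      ... | no w≢v = trans (sym (updateAt-minimal w v c w≢v)) (trans same c′y≡cy)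

    recoloured-valid : Is110Colouring H c → Is110Colouring H c′
    recoloured-valid valid y vy with y ≟ v
    ... | yes refl = subst (_≤ allow (c′ y)) (sym recoloured-free) z≤n
    ... | no y≢v = subst (λ k → clashes H c′ y ≤ allow k) (sym (updateAt-minimal y v c y≢v))
                     (≤-trans (recoloured-elsewhere y y≢v) (valid y vy))

  free-recolouring : (H : Subgraph G) {c : Fin n → Fin 3} → Is110Colouring H c →
    ∀ v → count (es H v) ≤ 2 →
    ∃ λ c′ → Is110Colouring H c′ × clashes H c′ v ≡ 0 × (∀ y → y ≢ v → clashes H c′ y ≤ clashes H c y)
  free-recolouring H {c} valid v deg≤2 =
    let (a , avoids) = unused-colour (es H v) deg≤2 c
        open Recolouring H c v a avoids
    in c′ , recoloured-valid valid , recoloured-free , recoloured-elsewhere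

  free-recolouring₂ : (H : Subgraph G) {c : Fin n → Fin 3} → Is110Colouring H c → ∀ {v w} → v ≢ w →
    count (es H v) ≤ 2 → count (es H w) ≤ 2 →
    ∃ λ c′ → Is110Colouring H c′ × clashes H c′ v ≡ 0 × clashes H c′ w ≡ 0
  free-recolouring₂ H valid {v} {w} v≢w v≤2 w≤2 =
    let (c₁ , valid₁ , free-v₁ , _) = free-recolouring H valid v v≤2
        (c₂ , valid₂ , free-w , others) = free-recolouring H valid₁ w w≤2
    in c₂ , valid₂ , n≤0⇒n≡0 (subst (clashes H c₂ v ≤_) free-v₁ (others v v≢w)) , free-w

_∖_ : ∀ {n} (G : Graph n) → Fin n → Subgraph G
G ∖ u = record
  { vs     = λ x → not ⌊ x ≟ u ⌋
  ; es     = λ x y → adj G x y ∧ not ⌊ x ≟ u ⌋ ∧ not ⌊ y ≟ u ⌋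
  ; es-sym = λ x y → cong₂ _∧_ (Graph.sym G x y) (∧-comm (not ⌊ x ≟ u ⌋) _)
  ; es⊆adj = λ x y → ∧-elimˡ
  ; es-vs  = λ x y e → ∧-elimˡ (∧-elimʳ {adj G x y} e)
  }

module _ {n : ℕ} (G : Graph n) (u : Fin n) where

  ∖-proper : Proper (G ∖ u)
  ∖-proper = inj₁ (u , cong not (⌊⌋-true (u ≟ u) refl))

  ∖-vs : ∀ {y} → y ≢ u → vs (G ∖ u) y ≡ true
  ∖-vs y≢u = cong not (⌊⌋-false (_ ≟ u) y≢u)

  ∖-es : ∀ {y} → y ≢ u → ∀ w → es (G ∖ u) y w ≡ adj G y w ∧ not ⌊ w ≟ u ⌋
  ∖-es {y} y≢u w rewrite ⌊⌋-false (y ≟ u) y≢u = refl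

  deg-∖ : ∀ {v} → Adj G u v → deg G v ≡ suc (count (es (G ∖ u) v))
  deg-∖ {v} uv = trans (count-remove (adj G v) u vu) (cong suc (count-cong (sym ∘ ∖-es (adj⇒≢ G vu))))
    where
    vu : Adj G v u
    vu = trans (Graph.sym G v u) uv

  module Extension (c : Fin n → Fin 3) (a : Fin 3) where

    c′ : Fin n → Fin 3
    c′ = updateAt c u (const a)

    clashes-centre : clashes (whole G) c′ u ≡ count (λ x → adj G u x ∧ ⌊ c x ≟ a ⌋)
    clashes-centre rewrite updateAt-updates u {const a} c = count-cong same
      where
      same : ∀ w → adj G u w ∧ ⌊ c′ w ≟ a ⌋ ≡ adj G u w ∧ ⌊ c w ≟ a ⌋
      same w with w ≟ u
      ... | yes refl rewrite irrefl G u = refl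
      ... | no w≢u rewrite updateAt-minimal w u {const a} c w≢u = refl

    clashes-elsewhere : ∀ {y} → y ≢ u →
      clashes (whole G) c′ y ≡ indicator (adj G y u ∧ ⌊ a ≟ c y ⌋) + clashes (G ∖ u) c y
    clashes-elsewhere {y} y≢u rewrite updateAt-minimal y u {const a} c y≢u
                                   | count-except (λ w → adj G y w ∧ ⌊ c′ w ≟ c y ⌋) u
                                   | updateAt-updates u {const a} c =
      cong (indicator (adj G y u ∧ ⌊ a ≟ c y ⌋) +_) (count-cong same)
      where
      same : ∀ w → (adj G y w ∧ ⌊ c′ w ≟ c y ⌋) ∧ not ⌊ w ≟ u ⌋ ≡ es (G ∖ u) y w ∧ ⌊ c w ≟ c y ⌋
      same w rewrite ∖-es y≢u w with w ≟ u
      ... | yes refl = trans (∧-zeroʳ _) (cong (_∧ ⌊ c u ≟ c y ⌋) (sym (∧-zeroʳ (adj G y u))))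
      ... | no w≢u rewrite updateAt-minimal w u {const a} c w≢u =
        trans (∧-identityʳ _) (cong (_∧ ⌊ c w ≟ c y ⌋) (sym (∧-identityʳ (adj G y w))))

    extend : Is110Colouring (G ∖ u) c →
      count (λ x → adj G u x ∧ ⌊ c x ≟ a ⌋) ≤ allow a →
      (∀ x → Adj G u x → c x ≡ a → clashes (G ∖ u) c x ≡ 0) →
      Is110Colouring (whole G) c′
    extend valid few-coloured-a slack y _ with y ≟ u
    ... | yes refl rewrite clashes-centre | updateAt-updates u {const a} c = few-coloured-a
    ... | no y≢u rewrite clashes-elsewhere y≢u | updateAt-minimal y u {const a} c y≢u
          with adj G y u in yu | a ≟ c y
    ...   | true | yes refl = begin
            1 + clashes (G ∖ u) c y  ≡⟨ cong suc (slack y uy refl) ⟩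
            1                        ≤⟨ count-witness y (∧-intro uy (⌊⌋-true (c y ≟ c y) refl)) ⟩
            count (λ x → adj G u x ∧ ⌊ c x ≟ c y ⌋) ≤⟨ few-coloured-a ⟩
            allow (c y)              ∎
            where
            open ≤-Reasoning
            uy : Adj G u y
            uy = trans (Graph.sym G u y) yu
    ...   | true | no _ = valid y (∖-vs y≢u)
    ...   | false | _ = valid y (∖-vs y≢u)

-- Constraints on the colour a of u, given the colours of v and w (which have no clash)
-- and of its remaining neighbour z (which may have one).
record Admissible (cv cw cz a : Fin 3) : Set where
  constructor admissible
  field
    avoids-z : cz ≢ a
    avoids-v-or-w : cv ≢ a ⊎ cw ≢ a
    slack : allow a ≡ 1 ⊎ cv ≢ a × cw ≢ a

admissible-colour : ∀ cv cw cz → ∃ (Admissible cv cw cz)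
admissible-colour ① _ ③ = ② , admissible (λ ()) (inj₁ (λ ())) (inj₁ refl)
admissible-colour ② _ ③ = ① , admissible (λ ()) (inj₁ (λ ())) (inj₁ refl)
admissible-colour ③ _ ③ = ① , admissible (λ ()) (inj₁ (λ ())) (inj₁ refl)
admissible-colour ① _ ① = ② , admissible (λ ()) (inj₁ (λ ())) (inj₁ refl)
admissible-colour ③ _ ① = ② , admissible (λ ()) (inj₁ (λ ())) (inj₁ refl)
admissible-colour ② ① ① = ② , admissible (λ ()) (inj₂ (λ ())) (inj₁ refl)
admissible-colour ② ③ ① = ② , admissible (λ ()) (inj₂ (λ ())) (inj₁ refl)
admissible-colour ② ② ① = ③ , admissible (λ ()) (inj₁ (λ ())) (inj₂ ((λ ()) , (λ ())))
admissible-colour ② _ ② = ① , admissible (λ ()) (inj₁ (λ ())) (inj₁ refl)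
admissible-colour ③ _ ② = ① , admissible (λ ()) (inj₁ (λ ())) (inj₁ refl)
admissible-colour ① ② ② = ① , admissible (λ ()) (inj₂ (λ ())) (inj₁ refl)
admissible-colour ① ③ ② = ① , admissible (λ ()) (inj₂ (λ ())) (inj₁ refl)
admissible-colour ① ① ② = ③ , admissible (λ ()) (inj₁ (λ ())) (inj₂ ((λ ()) , (λ ())))

module _ {n : ℕ} (G : Graph n) {u v w z : Fin n} (c : Fin n → Fin 3)
         (cover : ∀ y → Adj G u y → y ≡ v ⊎ y ≡ w ⊎ y ≡ z)
         {a : Fin 3} (adm : Admissible (c v) (c w) (c z) a) where

  open Admissible adm

  private
    both-coloured : c v ≡ a → c w ≡ a → ⊥
    both-coloured cv cw = [ (λ v-avoids → v-avoids cv) , (λ w-avoids → w-avoids cw) ]′ avoids-v-or-w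

    colour-a : ∀ x → adj G u x ∧ ⌊ c x ≟ a ⌋ ≡ true → c x ≡ a
    colour-a x ex = proj₂ (∧-⌊⌋ (c x ≟ a) ex)

  coloured-neighbour : ∀ {x} → Adj G u x → c x ≡ a → x ≡ v ⊎ x ≡ w
  coloured-neighbour ux cx with cover _ ux
  ... | inj₁ x≡v = inj₁ x≡v
  ... | inj₂ (inj₁ x≡w) = inj₂ x≡w
  ... | inj₂ (inj₂ refl) = ⊥-elim (avoids-z cx)

  coloured-unique : ∀ {x y} → Adj G u x → c x ≡ a → Adj G u y → c y ≡ a → x ≡ y
  coloured-unique ux cx uy cy with coloured-neighbour ux cx | coloured-neighbour uy cy
  ... | inj₁ refl | inj₁ refl = refl
  ... | inj₂ refl | inj₂ refl = refl
  ... | inj₁ refl | inj₂ refl = ⊥-elim (both-coloured cx cy)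
  ... | inj₂ refl | inj₁ refl = ⊥-elim (both-coloured cy cx)

  few-coloured-neighbours : count (λ x → adj G u x ∧ ⌊ c x ≟ a ⌋) ≤ allow a
  few-coloured-neighbours with slack
  ... | inj₁ allow≡1 = ≤-trans (unique⇒count≤1 λ x y ex ey →
          coloured-unique (∧-elimˡ ex) (colour-a x ex) (∧-elimˡ ey) (colour-a y ey)) (≤-reflexive (sym allow≡1))
  ... | inj₂ (v-avoids , w-avoids) = subst (_≤ allow a) (sym (count≡0 λ x ex →
          [ (λ { refl → v-avoids (colour-a x ex) }) , (λ { refl → w-avoids (colour-a x ex) }) ]′
            (coloured-neighbour (∧-elimˡ ex) (colour-a x ex)))) z≤n

minimal⇒no-degree≤3-cherry : ∀ {n} {G : Graph n} → Minimal110 G →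
  ∀ {u v w} → v ≢ w → Adj G u v → Adj G u w →
  deg G u ≤ 3 → deg G v ≤ 3 → deg G w ≤ 3 → ⊥
minimal⇒no-degree≤3-cherry {G = G} (uncolourable , proper-colourable) {u} {v} {w} v≢w uv uw du dv dw =
  let (c₀ , valid₀) = proper-colourable (G ∖ u) (∖-proper G u)
      (c , valid , free-v , free-w) = free-recolouring₂ (G ∖ u) valid₀ v≢w (deg-∖-≤ uv dv) (deg-∖-≤ uw dw)
      (z , cover) = count≤3⇒third uv uw v≢w du
      (a , adm) = admissible-colour (c v) (c w) (c z)
      free : ∀ x → Adj G u x → c x ≡ a → clashes (G ∖ u) c x ≡ 0
      free x ux cx = [ (λ { refl → free-v }) , (λ { refl → free-w }) ]′ (coloured-neighbour G c cover adm ux cx)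
      open Extension G u c a
  in uncolourable (c′ , extend valid (few-coloured-neighbours G c cover adm) free)
  where
  deg-∖-≤ : ∀ {y} → Adj G u y → deg G y ≤ 3 → count (es (G ∖ u) y) ≤ 2
  deg-∖-≤ uy dy = ≤-pred (subst (_≤ 3) (deg-∖ G u uy) dy)

lemma2p4 : ∀ (n : ℕ) (G : Graph n) → NoC4 G → NoC5 G → Minimal110 G →
    (∀ (u v w : Fin n) → v ≢ w → Adj G u v → Adj G u w →
       deg G u ≡ 3 → deg G v ≡ 3 → ¬ deg G w ≡ 3)
    ×
    (∀ (u v w x : Fin n) → Adj G u v → Adj G v w → Adj G w u →
       deg G u ≡ 3 → deg G v ≡ 3 → 5 ≤ deg G w →
       Adj G u x → x ≢ v → x ≢ w → 4 ≤ deg G x)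
lemma2p4 n G _ _ minimal =
  (λ u v w v≢w uv uw du dv dw →
     minimal⇒no-degree≤3-cherry minimal v≢w uv uw (≤-reflexive du) (≤-reflexive dv) (≤-reflexive dw)) ,
  (λ u v w x uv _ _ du dv _ ux x≢v _ → ≰⇒> λ dx≤3 →
     minimal⇒no-degree≤3-cherry minimal (x≢v ∘ sym) uv ux (≤-reflexive du) (≤-reflexive dv) dx≤3)
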